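{- Let $p$ be a prime and let $\bigl(I\colon\Pi_n\to\mathbb{Z}/p\mathbb{Z}\bigr)_{n\ge1}$ be a sequence of functions satisfying the chain rule: for all $n,k_1,\dots,k_n\ge1$, $\pi\in\Pi_n$, $\gamma^i\in\Pi_{k_i}$, $I(\pi\circ(\gamma^1,\dots,\gamma^n))=I(\pi)+\sum_i\pi_iI(\gamma^i)$. Let $\pi\in\Pi_n$ with $\pi_i\ne0$ for all $i$, for each $i$ let $k_i\ge1$ be an integer representing $\pi_i\in\mathbb{Z}/p\mathbb{Z}$, and let $k=\sum_{i=1}^nk_i$. Then $$I(\pi)=I(u_k)-\sum_{i=1}^nk_iI(u_{k_i}).$$
   Context: $\Pi_n=\{\pi\in(\mathbb{Z}/p\mathbb{Z})^n:\sum_i\pi_i=1\}$. For $\gamma^i=(\gamma^i_1,\dots,\gamma^i_{k_i})$, $\pi\circ(\gamma^1,\dots,\gamma^n)=(\pi_1\gamma^1_1,\dots,\pi_1\gamma^1_{k_1},\dots,\pi_n\gamma^n_1,\dots,\pi_n\gamma^n_{k_n})$. For $p\nmid m$, $u_m=(1/m,\dots,1/m)\in\Pi_m$ (note none of $k_1,\dots,k_n,k$ is divisible by $p$ under the hypotheses). -}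

module Defs where

open import Data.Nat as ℕ using (ℕ; zero; suc; NonZero)
open import Data.Nat.DivMod using (_mod_)
open import Data.Fin as Fin using (Fin; toℕ)
open import Data.Fin.Properties using (any?; _≟_)
open import Data.Vec as Vec using (Vec; []; _∷_; _++_; replicate)
open import Data.Product using (_,_)
open import Relation.Nullary using (yes; no)

module Zmod (p : ℕ) .{{_ : NonZero p}} where

  Zp : Set
  Zp = Fin p

  [_] : ℕ → Zp
  [ m ] = m mod p

  0# 1# : Zp
  0# = [ 0 ]
  1# = [ 1 ]

  _+_ : Zp → Zp → Zp
  a + b = [ toℕ a ℕ.+ toℕ b ]

  _*_ : Zp → Zp → Zp
  a * b = [ toℕ a ℕ.* toℕ b ]

  -_ : Zp → Zp
  - a = [ p ℕ.∸ toℕ a ]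

  _-_ : Zp → Zp → Zp
  a - b = a + (- b)

  infixl 6 _+_ _-_
  infixl 7 _*_

  -- multiplicative inverse: some x with a * x = 1 (unique when p is prime
  -- and a ≠ 0); 0 if none exists (never used in that case)
  inv : Zp → Zp
  inv a with any? (λ x → (a * x) ≟ 1#)
  ... | yes (x , _) = x
  ... | no _ = 0#

  vsum : ∀ {n} → Vec Zp n → Zp
  vsum [] = 0#
  vsum (x ∷ xs) = x + vsum xs

  Σ[_] : ∀ n → (Fin n → Zp) → Zp
  Σ[ zero ] f = 0#
  Σ[ suc n ] f = f Fin.zero + Σ[ n ] (λ i → f (Fin.suc i))

  InΠ : ∀ {n} → Vec Zp n → Set
  InΠ π = vsum π ≡ 1#
    where open import Relation.Binary.PropositionalEquality using (_≡_)

  ksum : ∀ n → (Fin n → ℕ) → ℕ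
  ksum zero k = 0
  ksum (suc n) k = k Fin.zero ℕ.+ ksum n (λ i → k (Fin.suc i))

  comp : ∀ {n} → Vec Zp n → (k : Fin n → ℕ) → ((i : Fin n) → Vec Zp (k i))
       → Vec Zp (ksum n k)
  comp [] k γ = []
  comp (x ∷ xs) k γ =
    Vec.map (x *_) (γ Fin.zero) ++ comp xs (λ i → k (Fin.suc i)) (λ i → γ (Fin.suc i))

  u : (m : ℕ) → Vec Zp m
  u m = replicate m (inv [ m ])

-- Take γⁱ = u_{kᵢ}. Since kᵢ ≡ πᵢ, every entry πᵢ·(1/kᵢ) of π ∘ (γ¹, …, γⁿ) is 1, and
-- since k ≡ Σ πᵢ = 1 we also have u_k = (1, …, 1), so π ∘ (γ¹, …, γⁿ) = u_k. The chain
-- rule then reads I(u_k) = I(π) + Σ kᵢ I(u_{kᵢ}). That the γⁱ lie in Π uses that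
-- ℤ/pℤ is a field: kᵢ ≢ 0 has an inverse, so u_{kᵢ} sums to kᵢ · kᵢ⁻¹ = 1.
module Submission where

open import Defs
open import Data.Nat as ℕ using (ℕ; zero; suc; NonZero; _≥_; _%_; s≤s; z≤n)
import Data.Nat.Properties as ℕₚ
open import Data.Nat.DivMod using (m%n<n; m<n⇒m%n≡m; %-distribˡ-+; %-distribˡ-*; [m+n]%n≡m%n; [m+kn]%n≡m%n)
open import Data.Nat.Coprimality as Coprime using (Coprime; coprime-Bézout; prime⇒coprime)
open import Data.Nat.GCD using (module Bézout)
open import Data.Nat.Primality using (Prime; prime⇒nonTrivial)
open import Data.Fin as Fin using (Fin; toℕ)
open import Data.Fin.Properties using (toℕ-fromℕ<; toℕ-injective; toℕ<n; any?) renaming (_≟_ to _≟ᶠ_)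
open import Data.Vec as Vec using (Vec; []; _∷_; _++_; lookup; replicate)
open import Data.Vec.Properties using (map-replicate)
open import Data.Product using (∃; _,_)
open import Data.Empty using (⊥-elim)
open import Relation.Nullary using (¬_; yes; no)
open import Relation.Binary.PropositionalEquality
  using (_≡_; _≢_; refl; sym; trans; cong; cong₂; module ≡-Reasoning)

open ≡-Reasoning

replicate-++ : ∀ {A : Set} m n (x : A) → replicate m x ++ replicate n x ≡ replicate (m ℕ.+ n) x
replicate-++ zero    n x = refl
replicate-++ (suc m) n x = cong (x ∷_) (replicate-++ m n x)

coprime⇒∃-inverse-% : ∀ {a n} .{{_ : NonZero n}} → Coprime a n → ∃ λ x → (a ℕ.* x) % n ≡ 1 % n
coprime⇒∃-inverse-% {a} {n@(suc n-1)} a⊥n with coprime-Bézout a⊥n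
... | Bézout.+- x y 1+yn≡xa = x , (begin
  (a ℕ.* x) % n         ≡⟨ cong (_% n) (trans (ℕₚ.*-comm a x) (sym 1+yn≡xa)) ⟩
  (1 ℕ.+ y ℕ.* n) % n   ≡⟨ [m+kn]%n≡m%n 1 y n ⟩
  1 % n                 ∎)
-- Here −x is the inverse; it is represented by x·(n − 1) since −1 ≡ n − 1.
... | Bézout.-+ x y 1+xa≡yn = x ℕ.* n-1 , (begin
  (a ℕ.* (x ℕ.* n-1)) % n              ≡⟨ cong (_% n) (reassoc a x n-1) ⟩
  (xa ℕ.* n-1) % n                     ≡⟨ sym ([m+kn]%n≡m%n (xa ℕ.* n-1) y n) ⟩
  (xa ℕ.* n-1 ℕ.+ y ℕ.* n) % n         ≡⟨ cong (λ z → (xa ℕ.* n-1 ℕ.+ z) % n) (sym 1+xa≡yn) ⟩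
  (xa ℕ.* n-1 ℕ.+ (1 ℕ.+ xa)) % n      ≡⟨ cong (_% n) (regroup xa n-1) ⟩
  (1 ℕ.+ xa ℕ.* n) % n                 ≡⟨ [m+kn]%n≡m%n 1 xa n ⟩
  1 % n                                ∎)
  where
  xa : ℕ
  xa = x ℕ.* a

  reassoc : ∀ a x m → a ℕ.* (x ℕ.* m) ≡ x ℕ.* a ℕ.* m
  reassoc a x m = begin
    a ℕ.* (x ℕ.* m)   ≡⟨ sym (ℕₚ.*-assoc a x m) ⟩
    a ℕ.* x ℕ.* m     ≡⟨ cong (ℕ._* m) (ℕₚ.*-comm a x) ⟩
    x ℕ.* a ℕ.* m     ∎

  regroup : ∀ b m → b ℕ.* m ℕ.+ (1 ℕ.+ b) ≡ 1 ℕ.+ b ℕ.* suc m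
  regroup b m = begin
    b ℕ.* m ℕ.+ (1 ℕ.+ b)   ≡⟨ ℕₚ.+-comm (b ℕ.* m) (1 ℕ.+ b) ⟩
    1 ℕ.+ (b ℕ.+ b ℕ.* m)   ≡⟨ cong (1 ℕ.+_) (sym (ℕₚ.*-suc b m)) ⟩
    1 ℕ.+ b ℕ.* suc m       ∎

module ZmodProperties (p : ℕ) .{{_ : NonZero p}} where
  open Zmod p

  toℕ-[] : ∀ m → toℕ [ m ] ≡ m % p
  toℕ-[] m = toℕ-fromℕ< (m%n<n m p)

  %-≡⇒[]-≡ : ∀ {a b} → a % p ≡ b % p → [ a ] ≡ [ b ]
  %-≡⇒[]-≡ {a} {b} eq = toℕ-injective (trans (toℕ-[] a) (trans eq (sym (toℕ-[] b))))

  [toℕ]≡id : ∀ x → [ toℕ x ] ≡ x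
  [toℕ]≡id x = toℕ-injective (trans (toℕ-[] (toℕ x)) (m<n⇒m%n≡m (toℕ<n x)))

  []-+ : ∀ a b → [ a ] + [ b ] ≡ [ a ℕ.+ b ]
  []-+ a b = %-≡⇒[]-≡ (trans (cong₂ (λ x y → (x ℕ.+ y) % p) (toℕ-[] a) (toℕ-[] b))
                             (sym (%-distribˡ-+ a b p)))

  []-* : ∀ a b → [ a ] * [ b ] ≡ [ a ℕ.* b ]
  []-* a b = %-≡⇒[]-≡ (trans (cong₂ (λ x y → (x ℕ.* y) % p) (toℕ-[] a) (toℕ-[] b))
                             (sym (%-distribˡ-* a b p)))

  *-identityˡ : ∀ x → 1# * x ≡ x
  *-identityˡ x = begin
    1# * x                 ≡⟨ cong (1# *_) (sym ([toℕ]≡id x)) ⟩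
    [ 1 ] * [ toℕ x ]      ≡⟨ []-* 1 (toℕ x) ⟩
    [ 1 ℕ.* toℕ x ]        ≡⟨ cong [_] (ℕₚ.*-identityˡ (toℕ x)) ⟩
    [ toℕ x ]              ≡⟨ [toℕ]≡id x ⟩
    x                      ∎

  *-zeroˡ : ∀ x → 0# * x ≡ 0#
  *-zeroˡ x = trans (cong (0# *_) (sym ([toℕ]≡id x))) ([]-* 0 (toℕ x))

  x+y-y≡x : ∀ x y → x + y - y ≡ x
  x+y-y≡x x y = begin
    [ a ℕ.+ b ] + [ p ℕ.∸ b ]     ≡⟨ []-+ (a ℕ.+ b) (p ℕ.∸ b) ⟩
    [ a ℕ.+ b ℕ.+ (p ℕ.∸ b) ]     ≡⟨ cong [_] (trans (ℕₚ.+-assoc a b (p ℕ.∸ b))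
                                       (cong (a ℕ.+_) (ℕₚ.m+[n∸m]≡n
                                         (ℕₚ.<⇒≤ (toℕ<n y))))) ⟩
    [ a ℕ.+ p ]                   ≡⟨ %-≡⇒[]-≡ ([m+n]%n≡m%n a p) ⟩
    [ a ]                         ≡⟨ [toℕ]≡id x ⟩
    x                             ∎
    where
    a b : ℕ
    a = toℕ x
    b = toℕ y

  inv-correct : ∀ a → (∃ λ x → a * x ≡ 1#) → a * inv a ≡ 1#
  inv-correct a a⁻¹ with any? (λ x → a * x ≟ᶠ 1#)
  ... | yes (_ , ax≡1) = ax≡1
  ... | no ∄x          = ⊥-elim (∄x a⁻¹)

  inv-1 : inv 1# ≡ 1#
  inv-1 = trans (sym (*-identityˡ (inv 1#))) (inv-correct 1# (1# , *-identityˡ 1#))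

  Σ-cong : ∀ n {f g : Fin n → Zp} → (∀ i → f i ≡ g i) → Σ[ n ] f ≡ Σ[ n ] g
  Σ-cong zero    f≡g = refl
  Σ-cong (suc n) f≡g = cong₂ _+_ (f≡g Fin.zero) (Σ-cong n (λ i → f≡g (Fin.suc i)))

  vsum-replicate : ∀ m c → vsum (replicate m c) ≡ [ m ] * c
  vsum-replicate zero    c = sym (*-zeroˡ c)
  vsum-replicate (suc m) c = begin
    c + vsum (replicate m c)         ≡⟨ cong (c +_) (vsum-replicate m c) ⟩
    c + [ m ] * c                    ≡⟨ cong (λ z → z + [ m ] * z) (sym ([toℕ]≡id c)) ⟩
    [ toℕ c ] + [ m ] * [ toℕ c ]    ≡⟨ cong ([ toℕ c ] +_) ([]-* m (toℕ c)) ⟩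
    [ toℕ c ] + [ m ℕ.* toℕ c ]      ≡⟨ []-+ (toℕ c) (m ℕ.* toℕ c) ⟩
    [ suc m ℕ.* toℕ c ]              ≡⟨ sym ([]-* (suc m) (toℕ c)) ⟩
    [ suc m ] * [ toℕ c ]            ≡⟨ cong ([ suc m ] *_) ([toℕ]≡id c) ⟩
    [ suc m ] * c                    ∎

  [ksum]≡vsum : ∀ {n} (π : Vec Zp n) (k : Fin n → ℕ) →
                (∀ i → [ k i ] ≡ lookup π i) → [ ksum n k ] ≡ vsum π
  [ksum]≡vsum []      k [k]≡π = refl
  [ksum]≡vsum (x ∷ π) k [k]≡π =
    trans (sym ([]-+ (k Fin.zero) _))
          (cong₂ _+_ ([k]≡π Fin.zero) ([ksum]≡vsum π (λ i → k (Fin.suc i)) (λ i → [k]≡π (Fin.suc i))))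

  u-[]≡1 : ∀ m → [ m ] ≡ 1# → u m ≡ replicate m 1#
  u-[]≡1 m [m]≡1 = cong (replicate m) (trans (cong inv [m]≡1) inv-1)

  comp-replicate : ∀ {n} (π : Vec Zp n) (k : Fin n → ℕ) (c : Fin n → Zp) →
                   (∀ i → lookup π i * c i ≡ 1#) →
                   comp π k (λ i → replicate (k i) (c i)) ≡ replicate (ksum n k) 1#
  comp-replicate []      k c πc≡1 = refl
  comp-replicate (x ∷ π) k c πc≡1 = begin
    Vec.map (x *_) (replicate k₀ (c Fin.zero)) ++ comp π k⁺ (λ i → replicate (k⁺ i) (c (Fin.suc i)))
      ≡⟨ cong₂ _++_ (trans (map-replicate (x *_) (c Fin.zero) k₀) (cong (replicate k₀) (πc≡1 Fin.zero)))
                    (comp-replicate π k⁺ (λ i → c (Fin.suc i)) (λ i → πc≡1 (Fin.suc i))) ⟩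
    replicate k₀ 1# ++ replicate (ksum _ k⁺) 1#
      ≡⟨ replicate-++ k₀ (ksum _ k⁺) 1# ⟩
    replicate (ksum _ k) 1#
      ∎
    where
    k₀ : ℕ
    k₀ = k Fin.zero
    k⁺ : Fin _ → ℕ
    k⁺ i = k (Fin.suc i)

module ZmodPrimeProperties (p : ℕ) .{{_ : NonZero p}} (p-prime : Prime p) where
  open Zmod p
  open ZmodProperties p

  Π₀-empty : ¬ InΠ {0} []
  Π₀-empty 0≡1 = ℕₚ.0≢1+n (begin
    0              ≡⟨ sym (m<n⇒m%n≡m (ℕₚ.<-trans ℕ.z<s 1<p)) ⟩
    0 % p          ≡⟨ sym (toℕ-[] 0) ⟩
    toℕ 0#         ≡⟨ cong toℕ 0≡1 ⟩
    toℕ 1#         ≡⟨ toℕ-[] 1 ⟩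
    1 % p          ≡⟨ m<n⇒m%n≡m 1<p ⟩
    1              ∎)
    where
    1<p : 1 ℕ.< p
    1<p = ℕ.nonTrivial⇒n>1 p {{prime⇒nonTrivial p-prime}}

  ∃-inverse : ∀ a → a ≢ 0# → ∃ λ x → a * x ≡ 1#
  ∃-inverse a a≢0 with coprime⇒∃-inverse-% {toℕ a} (Coprime.sym a⊥p)
    where
    toℕa≢0 : toℕ a ≢ 0
    toℕa≢0 toℕa≡0 = a≢0 (trans (sym ([toℕ]≡id a)) (cong [_] toℕa≡0))
    a⊥p : Coprime p (toℕ a)
    a⊥p = prime⇒coprime p-prime {{ℕ.≢-nonZero toℕa≢0}} (toℕ<n a)
  ... | x , ax≡1 = [ x ] , (begin
    a * [ x ]            ≡⟨ cong (_* [ x ]) (sym ([toℕ]≡id a)) ⟩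
    [ toℕ a ] * [ x ]    ≡⟨ []-* (toℕ a) x ⟩
    [ toℕ a ℕ.* x ]      ≡⟨ %-≡⇒[]-≡ ax≡1 ⟩
    1#                   ∎)

  *-inverseʳ : ∀ a → a ≢ 0# → a * inv a ≡ 1#
  *-inverseʳ a a≢0 = inv-correct a (∃-inverse a a≢0)

  u∈Π : ∀ m → [ m ] ≢ 0# → InΠ (u m)
  u∈Π m [m]≢0 = trans (vsum-replicate m (inv [ m ])) (*-inverseʳ [ m ] [m]≢0)

  comp-u : ∀ {n} (π : Vec Zp n) → InΠ π → (k : Fin n → ℕ) → (∀ i → [ k i ] ≡ lookup π i) →
           (∀ i → [ k i ] ≢ 0#) → comp π k (λ i → u (k i)) ≡ u (ksum n k)
  comp-u π π∈Π k [k]≡π [k]≢0 = begin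
    comp π k (λ i → u (k i))     ≡⟨ comp-replicate π k (λ i → inv [ k i ]) πᵢ/kᵢ≡1 ⟩
    replicate (ksum _ k) 1#      ≡⟨ sym (u-[]≡1 (ksum _ k) (trans ([ksum]≡vsum π k [k]≡π) π∈Π)) ⟩
    u (ksum _ k)                 ∎
    where
    πᵢ/kᵢ≡1 : ∀ i → lookup π i * inv [ k i ] ≡ 1#
    πᵢ/kᵢ≡1 i = trans (cong (_* inv [ k i ]) (sym ([k]≡π i))) (*-inverseʳ [ k i ] ([k]≢0 i))

lemma5p5 : (p : ℕ) .{{_ : NonZero p}} → Prime p →
    let open Zmod p in
    (I : (n : ℕ) → Vec Zp n → Zp) →
    -- chain rule
    (∀ (n : ℕ) → n ≥ 1 → (k : Fin n → ℕ) → (∀ i → k i ≥ 1) →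
       (π : Vec Zp n) → InΠ π →
       (γ : (i : Fin n) → Vec Zp (k i)) → (∀ i → InΠ (γ i)) →
       I (ksum n k) (comp π k γ) ≡ I n π + Σ[ n ] (λ i → lookup π i * I (k i) (γ i))) →
    (n : ℕ) → (π : Vec Zp n) → InΠ π → (∀ i → lookup π i ≢ 0#) →
    (k : Fin n → ℕ) → (∀ i → k i ≥ 1) → (∀ i → [ k i ] ≡ lookup π i) →
    I n π ≡ I (ksum n k) (u (ksum n k)) - Σ[ n ] (λ i → [ k i ] * I (k i) (u (k i)))
lemma5p5 p p-prime I chain zero [] π∈Π _ _ _ _ = ⊥-elim (Π₀-empty π∈Π)
  where open ZmodPrimeProperties p p-prime
lemma5p5 p p-prime I chain (suc n) π π∈Π π≢0 k k≥1 [k]≡π = begin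
  I (suc n) π                                     ≡⟨ sym (x+y-y≡x (I (suc n) π) S) ⟩
  I (suc n) π + S - S                             ≡⟨ cong (_- S) (sym chain-u) ⟩
  I K (u K) - S                                   ≡⟨ cong (λ s → I K (u K) - s) (Σ-cong (suc n) λ i →
                                                       cong (_* I (k i) (u (k i))) (sym ([k]≡π i))) ⟩
  I K (u K) - Σ[ suc n ] (λ i → [ k i ] * I (k i) (u (k i)))  ∎
  where
  open Zmod p
  open ZmodProperties p
  open ZmodPrimeProperties p p-prime
  K : ℕ
  K = ksum (suc n) k
  S : Zp
  S = Σ[ suc n ] (λ i → lookup π i * I (k i) (u (k i)))
  [k]≢0 : ∀ i → [ k i ] ≢ 0#
  [k]≢0 i [kᵢ]≡0 = π≢0 i (trans (sym ([k]≡π i)) [kᵢ]≡0)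
  chain-u : I K (u K) ≡ I (suc n) π + S
  chain-u = trans (cong (I K) (sym (comp-u π π∈Π k [k]≡π [k]≢0)))
                  (chain (suc n) (s≤s z≤n) k k≥1 π π∈Π (λ i → u (k i)) (λ i → u∈Π (k i) ([k]≢0 i)))
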